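{- Let $p>2$ be a prime, let $U=\mathbb{Z}_p^{p+1}$ with standard basis $e_1,\dots,e_{p+1}$ and $V=\mathbb{Z}_p^{p+2}$ with standard basis $f_0,f_1,\dots,f_{p+1}$, viewed as vector spaces over $\mathbb{Z}_p$. Equip $V$ with the bilinear form $\langle \sum_{i=0}^{p+1}\alpha_if_i,\sum_{i=0}^{p+1}\beta_if_i\rangle=\sum_{i=0}^{p+1}\alpha_i\beta_i$. Define, for $i=1,\dots,p+1$, $$A_i=e_i+\{v\in V:\langle v,f_0+f_i\rangle=0\},\qquad B_i=\sum_{j\ne i,\,1\le j\le p+1}e_j+\Big\{v\in V:\Big\langle v,f_i+\sum_{j=0}^{p+1}f_j\Big\rangle=0\Big\},$$ and $$C_0=\sum_{j=1}^{p+1}e_j+\Big\{v\in V:\Big\langle v,\sum_{j=0}^{p+1}f_j\Big\rangle=0\Big\},\qquad C_1=\sum_{j=1}^{p+1}e_j+\Big\{v\in V:\Big\langle v,\sum_{j=0}^{p+1}f_j\Big\rangle=1\Big\}.$$ Let $S=\bigcup_{i=1}^{p+1}(A_i\cup B_i)\cup C_0$ and $T=\bigcup_{i=1}^{p+1}(A_i\cup B_i)\cup C_1$, subsets of $U\oplus V$. Then there is no invertible linear transformation $\sigma\in GL(U\oplus V)$ such that $\sigma(S)=T$. -}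

module Defs where

open import Data.Nat using (ℕ; zero; suc; _+_; _*_; NonZero)
open import Data.Nat.DivMod using (_mod_)
open import Data.Fin using (Fin; toℕ) renaming (zero to fzero; suc to fsuc)
open import Data.Fin.Properties using (_≟_)
open import Data.Vec using (Vec; tabulate; zipWith; foldr; replicate)
open import Data.List using (List; map; filter; allFin)
import Data.List as L
open import Data.Product using (Σ; ∃; _×_; _,_)
open import Data.Sum using (_⊎_)
open import Relation.Nullary using (¬_; yes; no)
open import Relation.Nullary.Decidable using (¬?)
open import Relation.Binary.PropositionalEquality using (_≡_)

module Field (p : ℕ) {{_ : NonZero p}} where

  Zp : Set
  Zp = Fin p

  0ₚ 1ₚ : Zp
  0ₚ = 0 mod p
  1ₚ = 1 mod p

  _+ₚ_ _*ₚ_ : Zp → Zp → Zp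
  a +ₚ b = (toℕ a + toℕ b) mod p
  a *ₚ b = (toℕ a * toℕ b) mod p

  Vect : ℕ → Set
  Vect n = Vec Zp n

  zeroV : ∀ {n} → Vect n
  zeroV = replicate _ 0ₚ

  _⊕_ : ∀ {n} → Vect n → Vect n → Vect n
  _⊕_ = zipWith _+ₚ_

  _·_ : ∀ {n} → Zp → Vect n → Vect n
  c · v = Data.Vec.map (c *ₚ_) v

  ΣV : ∀ {n} → List (Vect n) → Vect n
  ΣV = L.foldr _⊕_ zeroV

  δ : ∀ {n} → Fin n → Fin n → Zp
  δ k j with j ≟ k
  ... | yes _ = 1ₚ
  ... | no _ = 0ₚ

  basis : ∀ {n} → Fin n → Vect n
  basis k = tabulate (δ k)

  ⟨_,_⟩ : ∀ {n} → Vect n → Vect n → Zp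
  ⟨ a , b ⟩ = foldr _ _+ₚ_ 0ₚ (zipWith _*ₚ_ a b)

  -- U = ℤ_p^{p+1}, basis e₁,…,e_{p+1}  (eᵢ is  e (i-1) : index in Fin (p+1))
  -- V = ℤ_p^{p+2}, basis f₀,f₁,…,f_{p+1} (fᵢ is f i : index in Fin (p+2))
  U V : Set
  U = Vect (suc p)
  V = Vect (suc (suc p))

  e : Fin (suc p) → U
  e = basis

  f : Fin (suc (suc p)) → V
  f = basis

  -- index i ∈ Fin (p+1) stands for i+1 ∈ {1,…,p+1}; fᵢ for such i is f (fsuc i)
  f' : Fin (suc p) → V
  f' i = f (fsuc i)

  W : Set
  W = U × V

  _⊕W_ : W → W → W
  (u , v) ⊕W (u' , v') = (u ⊕ u') , (v ⊕ v')

  _·W_ : Zp → W → W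
  c ·W (u , v) = (c · u) , (c · v)

  ΣU-except : Fin (suc p) → U
  ΣU-except i = ΣV (map e (filter (λ j → ¬? (j ≟ i)) (allFin (suc p))))

  ΣU : U
  ΣU = ΣV (map e (allFin (suc p)))

  ΣF : V
  ΣF = ΣV (map f (allFin (suc (suc p))))

  A : Fin (suc p) → W → Set
  A i (u , v) = u ≡ e i × ⟨ v , f fzero ⊕ f' i ⟩ ≡ 0ₚ

  B : Fin (suc p) → W → Set
  B i (u , v) = u ≡ ΣU-except i × ⟨ v , f' i ⊕ ΣF ⟩ ≡ 0ₚ

  C₀ C₁ : W → Set
  C₀ (u , v) = u ≡ ΣU × ⟨ v , ΣF ⟩ ≡ 0ₚ
  C₁ (u , v) = u ≡ ΣU × ⟨ v , ΣF ⟩ ≡ 1ₚ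

  S T : W → Set
  S w = (∃ λ i → A i w ⊎ B i w) ⊎ C₀ w
  T w = (∃ λ i → A i w ⊎ B i w) ⊎ C₁ w

  IsGL : (W → W) → Set
  IsGL σ = (∀ x y → σ (x ⊕W y) ≡ σ x ⊕W σ y)
         × (∀ (c : Zp) x → σ (c ·W x) ≡ c ·W σ x)
         × (Σ (W → W) λ τ → (∀ x → τ (σ x) ≡ x) × (∀ y → σ (τ y) ≡ y))

  MapsOnto : (W → W) → (W → Set) → (W → Set) → Set
  MapsOnto σ P Q = (∀ w → P w → Q (σ w)) × (∀ w' → Q w' → ∃ λ w → P w × σ w ≡ w')

-- Only additivity of σ and σ(S) ⊆ T are used, and only p > 2 rather than primality.
-- The points z = (ΣU, 0), xᵢ = (eᵢ, 0) and yᵢ = (ΣU − eᵢ, 0) lie in C₀, Aᵢ and Bᵢ, and xᵢ + yᵢ = z.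
-- The U-components of points of T are eⱼ, ΣU − eⱼ and ΣU: 0/1-vectors with coordinate sum 0 or 1.
-- As 2 ∉ {0, 1} in ℤ/p, a sum of two of them that is again one of them must be eⱼ + (ΣU − eⱼ);
-- so σ(z) ∈ C₁ and {σ(xᵢ), σ(yᵢ)} consists of a point of Aⱼ and a point of Bⱼ, for some j.
-- Let γ be the V-component of σ(z) without its f₀-coordinate, and consider the linear functional
--   Ψ(u, v) = ⟨u, γ⟩ + 2 Σₖ uₖ − Σ_{k ≥ 1} vₖ.
-- It equals 2 at σ(z), and the linear conditions defining Aⱼ, Bⱼ and C₁ force it to be 1 on the
-- Aⱼ-point, hence by additivity also on the Bⱼ-point. Thus Ψ(σ(xᵢ)) = 1 for all i, and summing
-- over the p + 1 indices gives Ψ(σ(z)) = p + 1 = 1, a contradiction.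
module Submission where

open import Defs
open import Level using (0ℓ)
open import Algebra.Bundles using (CommutativeRing)
open import Algebra.Consequences.Propositional using (comm∧idˡ⇒id; comm∧invˡ⇒inv; comm∧distrʳ⇒distrˡ)
import Algebra.Properties.CommutativeSemigroup as CommutativeSemigroupProperties
import Algebra.Properties.Ring as RingProperties
open import Data.Bool using (if_then_else_; true; false)
open import Data.Empty using (⊥; ⊥-elim)
open import Data.Fin using (Fin; toℕ) renaming (zero to fzero; suc to fsuc)
open import Data.Fin.Properties using (_≟_; toℕ-fromℕ<; toℕ<n; toℕ-injective)
open import Data.List using (List; []; _∷_; foldr; map; filter; allFin; length)
import Data.List.Properties as Listₚ
open import Data.Nat as ℕ using (ℕ; zero; suc; _+_; _*_; _∸_; _%_; _<_; s≤s; NonZero)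
open import Data.Nat.DivMod
  using (_mod_; %-distribˡ-+; %-distribˡ-*; m%n%n≡m%n; m<n⇒m%n≡m; n%n≡0; m*n%n≡0; [m+n]%n≡m%n)
open import Data.Nat.Primality using (Prime)
import Data.Nat.Properties as ℕ
open import Data.Product using (Σ; ∃; _×_; _,_; proj₁; proj₂)
open import Data.Sum using (_⊎_; inj₁; inj₂)
open import Data.Vec using ([]; _∷_; lookup; tail)
open import Data.Vec.Properties
  using (lookup-zipWith; lookup∘tabulate; tabulate-cong; tabulate∘lookup; tabulate-allFin; map-const;
         zipWith-comm; zipWith-identityˡ)
open import Function using (_∘_)
open import Relation.Binary.PropositionalEquality
  using (_≡_; _≢_; refl; sym; trans; cong; cong₂; subst; isEquivalence; module ≡-Reasoning)
open import Relation.Nullary using (¬_; yes; no; does; contradiction)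
open import Relation.Nullary.Decidable using (¬?)
open import Relation.Unary using (Decidable)

module ZMod (p : ℕ) {{_ : NonZero p}} where
  open Field p

  ⟦_⟧ : ℕ → Zp
  ⟦ n ⟧ = n mod p

  private
    toℕ-⟦⟧ : ∀ n → toℕ ⟦ n ⟧ ≡ n % p
    toℕ-⟦⟧ n = toℕ-fromℕ< _

    toℕ-⟦⟧-% : ∀ n → toℕ ⟦ n ⟧ % p ≡ n % p
    toℕ-⟦⟧-% n = trans (cong (_% p) (toℕ-⟦⟧ n)) (m%n%n≡m%n n p)

    ⟦⟧-toℕ : ∀ a → ⟦ toℕ a ⟧ ≡ a
    ⟦⟧-toℕ a = toℕ-injective (trans (toℕ-⟦⟧ (toℕ a)) (m<n⇒m%n≡m (toℕ<n a)))

    ⟦⟧-cong : ∀ {m n} → m % p ≡ n % p → ⟦ m ⟧ ≡ ⟦ n ⟧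
    ⟦⟧-cong {m} {n} eq = toℕ-injective (trans (toℕ-⟦⟧ m) (trans eq (sym (toℕ-⟦⟧ n))))

    +-cong-% : ∀ {m m' n n'} → m % p ≡ m' % p → n % p ≡ n' % p → ⟦ m + n ⟧ ≡ ⟦ m' + n' ⟧
    +-cong-% {m} {m'} {n} {n'} eqm eqn = ⟦⟧-cong (trans (%-distribˡ-+ m n p)
      (trans (cong₂ (λ x y → (x + y) % p) eqm eqn) (sym (%-distribˡ-+ m' n' p))))

    *-cong-% : ∀ {m m' n n'} → m % p ≡ m' % p → n % p ≡ n' % p → ⟦ m * n ⟧ ≡ ⟦ m' * n' ⟧
    *-cong-% {m} {m'} {n} {n'} eqm eqn = ⟦⟧-cong (trans (%-distribˡ-* m n p)
      (trans (cong₂ (λ x y → (x * y) % p) eqm eqn) (sym (%-distribˡ-* m' n' p))))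

    -ₚ_ : Zp → Zp
    -ₚ a = ⟦ p ∸ toℕ a ⟧

    +ₚ-assoc : ∀ a b c → (a +ₚ b) +ₚ c ≡ a +ₚ (b +ₚ c)
    +ₚ-assoc a b c = trans (+-cong-% (toℕ-⟦⟧-% _) refl)
      (trans (cong ⟦_⟧ (ℕ.+-assoc (toℕ a) (toℕ b) (toℕ c))) (+-cong-% {toℕ a} refl (sym (toℕ-⟦⟧-% _))))

    +ₚ-comm : ∀ a b → a +ₚ b ≡ b +ₚ a
    +ₚ-comm a b = cong ⟦_⟧ (ℕ.+-comm (toℕ a) (toℕ b))

    +ₚ-identityˡ : ∀ a → 0ₚ +ₚ a ≡ a
    +ₚ-identityˡ a = trans (+-cong-% (toℕ-⟦⟧-% 0) refl) (⟦⟧-toℕ a)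

    -ₚ-inverseˡ : ∀ a → (-ₚ a) +ₚ a ≡ 0ₚ
    -ₚ-inverseˡ a = trans (+-cong-% (toℕ-⟦⟧-% (p ∸ toℕ a)) refl)
      (trans (cong ⟦_⟧ (ℕ.m∸n+n≡m (ℕ.<⇒≤ (toℕ<n a)))) (⟦⟧-cong (trans (n%n≡0 p) (sym (m*n%n≡0 0 p)))))

    *ₚ-assoc : ∀ a b c → (a *ₚ b) *ₚ c ≡ a *ₚ (b *ₚ c)
    *ₚ-assoc a b c = trans (*-cong-% (toℕ-⟦⟧-% _) refl)
      (trans (cong ⟦_⟧ (ℕ.*-assoc (toℕ a) (toℕ b) (toℕ c))) (*-cong-% {toℕ a} refl (sym (toℕ-⟦⟧-% _))))

    *ₚ-comm : ∀ a b → a *ₚ b ≡ b *ₚ a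
    *ₚ-comm a b = cong ⟦_⟧ (ℕ.*-comm (toℕ a) (toℕ b))

    *ₚ-identityˡ : ∀ a → 1ₚ *ₚ a ≡ a
    *ₚ-identityˡ a = trans (*-cong-% (toℕ-⟦⟧-% 1) refl)
      (trans (cong ⟦_⟧ (ℕ.*-identityˡ (toℕ a))) (⟦⟧-toℕ a))

    *ₚ-distribʳ-+ₚ : ∀ a b c → (b +ₚ c) *ₚ a ≡ (b *ₚ a) +ₚ (c *ₚ a)
    *ₚ-distribʳ-+ₚ a b c = trans (*-cong-% (toℕ-⟦⟧-% _) refl)
      (trans (cong ⟦_⟧ (ℕ.*-distribʳ-+ (toℕ a) (toℕ b) (toℕ c)))
             (+-cong-% (sym (toℕ-⟦⟧-% _)) (sym (toℕ-⟦⟧-% _))))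

  +-*-commutativeRing : CommutativeRing 0ℓ 0ℓ
  +-*-commutativeRing = record
    { Carrier = Zp ; _≈_ = _≡_ ; _+_ = _+ₚ_ ; _*_ = _*ₚ_ ; -_ = -ₚ_ ; 0# = 0ₚ ; 1# = 1ₚ
    ; isCommutativeRing = record
      { isRing = record
        { +-isAbelianGroup = record
          { isGroup = record
            { isMonoid = record
              { isSemigroup = record
                { isMagma = record { isEquivalence = isEquivalence ; ∙-cong = cong₂ _+ₚ_ }
                ; assoc = +ₚ-assoc }
              ; identity = comm∧idˡ⇒id +ₚ-comm +ₚ-identityˡ }
            ; inverse = comm∧invˡ⇒inv +ₚ-comm -ₚ-inverseˡ
            ; ⁻¹-cong = cong -ₚ_ }
          ; comm = +ₚ-comm }
        ; *-cong = cong₂ _*ₚ_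
        ; *-assoc = *ₚ-assoc
        ; *-identity = comm∧idˡ⇒id *ₚ-comm *ₚ-identityˡ
        ; distrib = comm∧distrʳ⇒distrˡ *ₚ-comm *ₚ-distribʳ-+ₚ , *ₚ-distribʳ-+ₚ }
      ; *-comm = *ₚ-comm } }

  open CommutativeRing +-*-commutativeRing public
    using (+-commutativeMonoid; +-assoc; +-comm; +-identityˡ; +-identityʳ; *-comm; *-identityʳ; distribʳ; zeroʳ)
    renaming (_-_ to _-ₚ_)
  open RingProperties (CommutativeRing.ring +-*-commutativeRing) public
    using (+-cancelˡ; +-cancelʳ; -‿+-comm; xyx⁻¹≈y)
  open CommutativeSemigroupProperties (CommutativeRing.+-commutativeSemigroup +-*-commutativeRing) public
    using (interchange)

  ⟦⟧-+ : ∀ m n → ⟦ m + n ⟧ ≡ ⟦ m ⟧ +ₚ ⟦ n ⟧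
  ⟦⟧-+ m n = +-cong-% (sym (toℕ-⟦⟧-% m)) (sym (toℕ-⟦⟧-% n))

  ⟦1+p⟧≡1 : ⟦ suc p ⟧ ≡ 1ₚ
  ⟦1+p⟧≡1 = ⟦⟧-cong ([m+n]%n≡m%n 1 p)

  +-minus-interchange : ∀ x x' y y' → (x +ₚ x') -ₚ (y +ₚ y') ≡ (x -ₚ y) +ₚ (x' -ₚ y')
  +-minus-interchange x x' y y' = trans (cong ((x +ₚ x') +ₚ_) (sym (-‿+-comm y y'))) (interchange x x' _ _)

  IsBit : Zp → Set
  IsBit a = a ≡ 0ₚ ⊎ a ≡ 1ₚ

  sumₚ : List Zp → Zp
  sumₚ = foldr _+ₚ_ 0ₚ

  sum-ones : ∀ {A : Set} (l : List A) → sumₚ (map (λ _ → 1ₚ) l) ≡ ⟦ length l ⟧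
  sum-ones []      = refl
  sum-ones (_ ∷ l) = trans (cong (1ₚ +ₚ_) (sum-ones l)) (sym (⟦⟧-+ 1 (length l)))

  sum-zeros : ∀ {A : Set} (l : List A) → sumₚ (map (λ _ → 0ₚ) l) ≡ 0ₚ
  sum-zeros []      = refl
  sum-zeros (_ ∷ l) = trans (cong (0ₚ +ₚ_) (sum-zeros l)) (+-identityˡ 0ₚ)

  sum-filter : ∀ {A : Set} {P : A → Set} (P? : Decidable P) (h : A → Zp) l →
    sumₚ (map h (filter P? l)) ≡ sumₚ (map (λ j → if does (P? j) then h j else 0ₚ) l)
  sum-filter P? h [] = refl
  sum-filter P? h (j ∷ l) with does (P? j)
  ... | true  = cong (h j +ₚ_) (sum-filter P? h l)
  ... | false = trans (sum-filter P? h l) (sym (+-identityˡ _))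

  sum-allFin-suc : ∀ {n} (h : Fin (suc n) → Zp) →
    sumₚ (map h (allFin (suc n))) ≡ h fzero +ₚ sumₚ (map (h ∘ fsuc) (allFin n))
  sum-allFin-suc h = cong (λ l → h fzero +ₚ sumₚ l)
    (trans (Listₚ.map-tabulate fsuc h) (sym (Listₚ.map-tabulate (λ i → i) (h ∘ fsuc))))

  Additive : ∀ {n} → (Vect n → Zp) → Set
  Additive g = ∀ x y → g (x ⊕ y) ≡ g x +ₚ g y

  ⊕-comm : ∀ {n} (x y : Vect n) → x ⊕ y ≡ y ⊕ x
  ⊕-comm = zipWith-comm +-comm

  ⊕-identityˡ : ∀ {n} (x : Vect n) → zeroV ⊕ x ≡ x
  ⊕-identityˡ = zipWith-identityˡ +-identityˡ

  lookup-⊕ : ∀ {n} (x y : Vect n) i → lookup (x ⊕ y) i ≡ lookup x i +ₚ lookup y i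
  lookup-⊕ x y i = lookup-zipWith _+ₚ_ i x y

  lookup-ext : ∀ {n} {x y : Vect n} → (∀ i → lookup x i ≡ lookup y i) → x ≡ y
  lookup-ext {x = x} {y} eq = trans (sym (tabulate∘lookup x)) (trans (tabulate-cong eq) (tabulate∘lookup y))

  additive⇒zero : ∀ {n} (g : Vect n → Zp) → Additive g → g zeroV ≡ 0ₚ
  additive⇒zero g g-additive = sym (+-cancelˡ (g zeroV) 0ₚ (g zeroV) (begin
    g zeroV +ₚ 0ₚ       ≡⟨ +-identityʳ (g zeroV) ⟩
    g zeroV             ≡⟨ cong g (⊕-identityˡ zeroV) ⟨
    g (zeroV ⊕ zeroV)   ≡⟨ g-additive zeroV zeroV ⟩
    g zeroV +ₚ g zeroV  ∎))
    where open ≡-Reasoning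

  additive-ΣV : ∀ {n} (g : Vect n → Zp) → Additive g → ∀ vs → g (ΣV vs) ≡ sumₚ (map g vs)
  additive-ΣV g g-additive []       = additive⇒zero g g-additive
  additive-ΣV g g-additive (v ∷ vs) =
    trans (g-additive v (ΣV vs)) (cong (g v +ₚ_) (additive-ΣV g g-additive vs))

  additive-ΣV-basis : ∀ {n} (g : Vect n → Zp) → Additive g → ∀ is →
    g (ΣV (map basis is)) ≡ sumₚ (map (g ∘ basis) is)
  additive-ΣV-basis g g-additive is =
    trans (additive-ΣV g g-additive (map basis is)) (cong sumₚ (sym (Listₚ.map-∘ is)))

  δ-diag : ∀ {n} (i : Fin n) → δ i i ≡ 1ₚ
  δ-diag i with i ≟ i
  ... | yes _  = refl
  ... | no i≢i = contradiction refl i≢i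

  δ-≢ : ∀ {n} {i j : Fin n} → j ≢ i → δ i j ≡ 0ₚ
  δ-≢ {i = i} {j} j≢i with j ≟ i
  ... | yes j≡i = contradiction j≡i j≢i
  ... | no _    = refl

  δ-suc : ∀ {n} (i j : Fin n) → δ (fsuc i) (fsuc j) ≡ δ i j
  δ-suc i j with j ≟ i
  ... | yes _ = refl
  ... | no _  = refl

  δ-bit : ∀ {n} (i j : Fin n) → IsBit (δ i j)
  δ-bit i j with j ≟ i
  ... | yes _ = inj₂ refl
  ... | no _  = inj₁ refl

  sum-δ : ∀ {n} (j : Fin n) → sumₚ (map (λ i → δ i j) (allFin n)) ≡ 1ₚ
  sum-δ {suc n} fzero = trans (sum-allFin-suc {n} (λ i → δ i fzero))
    (trans (cong (1ₚ +ₚ_) (sum-zeros (allFin n))) (+-identityʳ 1ₚ))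
  sum-δ {suc n} (fsuc j) = trans (sum-allFin-suc {n} (λ i → δ i (fsuc j)))
    (trans (+-identityˡ _) (trans (cong sumₚ (Listₚ.map-cong (λ i → δ-suc i j) (allFin n))) (sum-δ j)))

  lookup-basis : ∀ {n} (i j : Fin n) → lookup (basis i) j ≡ δ i j
  lookup-basis i j = lookup∘tabulate (δ i) j

  lookup-basis-diag : ∀ {n} (i : Fin n) → lookup (basis i) i ≡ 1ₚ
  lookup-basis-diag i = trans (lookup-basis i i) (δ-diag i)

  lookup-basis-≢ : ∀ {n} {i j : Fin n} → j ≢ i → lookup (basis i) j ≡ 0ₚ
  lookup-basis-≢ {i = i} {j} j≢i = trans (lookup-basis i j) (δ-≢ j≢i)

  basis-zero : ∀ {n} → basis {suc n} fzero ≡ 1ₚ ∷ zeroV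
  basis-zero = cong (1ₚ ∷_) (trans (tabulate-allFin _) (map-const _ 0ₚ))

  basis-suc : ∀ {n} (i : Fin n) → basis (fsuc i) ≡ 0ₚ ∷ basis i
  basis-suc i = cong (0ₚ ∷_) (tabulate-cong (δ-suc i))

  lookup-ΣV-basis : ∀ {n} (is : List (Fin n)) j → lookup (ΣV (map basis is)) j ≡ sumₚ (map (λ i → δ i j) is)
  lookup-ΣV-basis is j = trans (additive-ΣV-basis (λ v → lookup v j) (λ x y → lookup-⊕ x y j) is)
    (cong sumₚ (Listₚ.map-cong (λ i → lookup-basis i j) is))

  ones : ∀ n → Vect n
  ones n = ΣV (map basis (allFin n))

  ones-except : ∀ {n} → Fin n → Vect n
  ones-except {n} i = ΣV (map basis (filter (λ j → ¬? (j ≟ i)) (allFin n)))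

  lookup-ones : ∀ {n} (j : Fin n) → lookup (ones n) j ≡ 1ₚ
  lookup-ones {n} j = trans (lookup-ΣV-basis (allFin n) j) (sum-δ j)

  ones-suc : ∀ {n} → ones (suc n) ≡ 1ₚ ∷ ones n
  ones-suc {n} = lookup-ext λ where
    fzero    → lookup-ones {suc n} fzero
    (fsuc k) → trans (lookup-ones {suc n} (fsuc k)) (sym (lookup-ones k))

  additive-on-ones : ∀ {n} (g : Vect n → Zp) → Additive g → (∀ i → g (basis i) ≡ 1ₚ) → g (ones n) ≡ ⟦ n ⟧
  additive-on-ones {n} g g-additive g-basis = begin
    g (ones n)                          ≡⟨ additive-ΣV-basis g g-additive (allFin n) ⟩
    sumₚ (map (g ∘ basis) (allFin n))   ≡⟨ cong sumₚ (Listₚ.map-cong g-basis (allFin n)) ⟩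
    sumₚ (map (λ _ → 1ₚ) (allFin n))    ≡⟨ sum-ones (allFin n) ⟩
    ⟦ length (allFin n) ⟧               ≡⟨ cong ⟦_⟧ (Listₚ.length-tabulate _) ⟩
    ⟦ n ⟧                               ∎
    where open ≡-Reasoning

  private
    lookup-ones-except : ∀ {n} (i k : Fin n) →
      lookup (ones-except i) k ≡ sumₚ (map (λ j → if does (¬? (j ≟ i)) then δ j k else 0ₚ) (allFin n))
    lookup-ones-except {n} i k = trans (lookup-ΣV-basis (filter (λ j → ¬? (j ≟ i)) (allFin n)) k)
      (sum-filter (λ j → ¬? (j ≟ i)) (λ j → δ j k) (allFin n))

  lookup-ones-except-self : ∀ {n} (i : Fin n) → lookup (ones-except i) i ≡ 0ₚ
  lookup-ones-except-self {n} i = trans (lookup-ones-except i i)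
    (trans (cong sumₚ (Listₚ.map-cong masked-zero (allFin n))) (sum-zeros (allFin n)))
    where
    masked-zero : ∀ j → (if does (¬? (j ≟ i)) then δ j i else 0ₚ) ≡ 0ₚ
    masked-zero j with j ≟ i
    ... | yes _  = refl
    ... | no j≢i = δ-≢ (λ i≡j → j≢i (sym i≡j))

  lookup-ones-except-≢ : ∀ {n} {i k : Fin n} → k ≢ i → lookup (ones-except i) k ≡ 1ₚ
  lookup-ones-except-≢ {n} {i} {k} k≢i = trans (lookup-ones-except i k)
    (trans (cong sumₚ (Listₚ.map-cong masked-δ (allFin n))) (sum-δ k))
    where
    masked-δ : ∀ j → (if does (¬? (j ≟ i)) then δ j k else 0ₚ) ≡ δ j k
    masked-δ j with j ≟ i
    ... | yes refl = sym (δ-≢ k≢i)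
    ... | no _     = refl

  basis⊕ones-except : ∀ {n} (i : Fin n) → basis i ⊕ ones-except i ≡ ones n
  basis⊕ones-except i = lookup-ext λ k →
    trans (lookup-⊕ (basis i) (ones-except i) k) (trans (coordinate k) (sym (lookup-ones k)))
    where
    coordinate : ∀ k → lookup (basis i) k +ₚ lookup (ones-except i) k ≡ 1ₚ
    coordinate k with k ≟ i
    ... | yes refl = trans (cong₂ _+ₚ_ (lookup-basis-diag k) (lookup-ones-except-self k)) (+-identityʳ 1ₚ)
    ... | no k≢i   = trans (cong₂ _+ₚ_ (lookup-basis-≢ k≢i) (lookup-ones-except-≢ k≢i)) (+-identityˡ 1ₚ)

  ⟨⟩-comm : ∀ {n} (x y : Vect n) → ⟨ x , y ⟩ ≡ ⟨ y , x ⟩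
  ⟨⟩-comm []      []      = refl
  ⟨⟩-comm (a ∷ x) (b ∷ y) = cong₂ _+ₚ_ (*-comm a b) (⟨⟩-comm x y)

  ⟨⟩-distribˡ : ∀ {n} (x y z : Vect n) → ⟨ x ⊕ y , z ⟩ ≡ ⟨ x , z ⟩ +ₚ ⟨ y , z ⟩
  ⟨⟩-distribˡ []      []      []      = sym (+-identityˡ 0ₚ)
  ⟨⟩-distribˡ (a ∷ x) (b ∷ y) (c ∷ z) = trans (cong₂ _+ₚ_ (distribʳ c a b) (⟨⟩-distribˡ x y z))
    (interchange (a *ₚ c) (b *ₚ c) ⟨ x , z ⟩ ⟨ y , z ⟩)

  ⟨⟩-distribʳ : ∀ {n} (x y z : Vect n) → ⟨ x , y ⊕ z ⟩ ≡ ⟨ x , y ⟩ +ₚ ⟨ x , z ⟩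
  ⟨⟩-distribʳ x y z = trans (⟨⟩-comm x (y ⊕ z))
    (trans (⟨⟩-distribˡ y z x) (cong₂ _+ₚ_ (⟨⟩-comm y x) (⟨⟩-comm z x)))

  ⟨⟩-zeroˡ : ∀ {n} (y : Vect n) → ⟨ zeroV , y ⟩ ≡ 0ₚ
  ⟨⟩-zeroˡ y = additive⇒zero (λ x → ⟨ x , y ⟩) (λ x x' → ⟨⟩-distribˡ x x' y)

  ⟨⟩-basisʳ : ∀ {n} (x : Vect n) i → ⟨ x , basis i ⟩ ≡ lookup x i
  ⟨⟩-basisʳ (a ∷ x) fzero = begin
    ⟨ a ∷ x , basis fzero ⟩       ≡⟨ cong (λ b → ⟨ a ∷ x , b ⟩) basis-zero ⟩
    (a *ₚ 1ₚ) +ₚ ⟨ x , zeroV ⟩    ≡⟨ cong₂ _+ₚ_ (*-identityʳ a) (trans (⟨⟩-comm x zeroV) (⟨⟩-zeroˡ x)) ⟩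
    a +ₚ 0ₚ                       ≡⟨ +-identityʳ a ⟩
    a                             ∎
    where open ≡-Reasoning
  ⟨⟩-basisʳ (a ∷ x) (fsuc i) = begin
    ⟨ a ∷ x , basis (fsuc i) ⟩    ≡⟨ cong (λ b → ⟨ a ∷ x , b ⟩) (basis-suc i) ⟩
    (a *ₚ 0ₚ) +ₚ ⟨ x , basis i ⟩  ≡⟨ cong₂ _+ₚ_ (zeroʳ a) (⟨⟩-basisʳ x i) ⟩
    0ₚ +ₚ lookup x i              ≡⟨ +-identityˡ (lookup x i) ⟩
    lookup x i                    ∎
    where open ≡-Reasoning

fresh : ∀ {n} (i j : Fin (suc (suc (suc n)))) → ∃ λ k → k ≢ i × k ≢ j
fresh fzero           fzero           = fsuc fzero , (λ ()) , (λ ())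
fresh fzero           (fsuc fzero)    = fsuc (fsuc fzero) , (λ ()) , (λ ())
fresh fzero           (fsuc (fsuc _)) = fsuc fzero , (λ ()) , (λ ())
fresh (fsuc fzero)    fzero           = fsuc (fsuc fzero) , (λ ()) , (λ ())
fresh (fsuc fzero)    (fsuc _)        = fzero , (λ ()) , (λ ())
fresh (fsuc (fsuc _)) fzero           = fsuc fzero , (λ ()) , (λ ())
fresh (fsuc (fsuc _)) (fsuc _)        = fzero , (λ ()) , (λ ())

module Configuration (m : ℕ) where
  p : ℕ
  p = suc (suc (suc m))

  open Field p
  open ZMod p
  open import Algebra.Solver.CommutativeMonoid +-commutativeMonoid using (solve; _⊜_) renaming (_⊕_ to _⊞_)

  -- Besides `fresh`, the only use of p > 2: 2 is neither 0 nor 1 in ℤ/p.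
  two-not-bit : ¬ IsBit (1ₚ +ₚ 1ₚ)
  two-not-bit (inj₁ ())
  two-not-bit (inj₂ ())

  total : U → Zp
  total u = ⟨ u , ΣU ⟩

  total-additive : Additive total
  total-additive x y = ⟨⟩-distribˡ x y ΣU

  total-e : ∀ i → total (e i) ≡ 1ₚ
  total-e i = trans (⟨⟩-comm (e i) ΣU) (trans (⟨⟩-basisʳ ΣU i) (lookup-ones i))

  total-ΣU : total ΣU ≡ 1ₚ
  total-ΣU = trans (additive-on-ones total total-additive total-e) ⟦1+p⟧≡1

  total-ΣU-except : ∀ i → total (ΣU-except i) ≡ 0ₚ
  total-ΣU-except i = +-cancelˡ 1ₚ _ _ (begin
    1ₚ +ₚ total (ΣU-except i)           ≡⟨ cong (_+ₚ total (ΣU-except i)) (total-e i) ⟨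
    total (e i) +ₚ total (ΣU-except i)  ≡⟨ total-additive (e i) (ΣU-except i) ⟨
    total (e i ⊕ ΣU-except i)           ≡⟨ cong total (basis⊕ones-except i) ⟩
    total ΣU                            ≡⟨ total-ΣU ⟩
    1ₚ                                  ≡⟨ +-identityʳ 1ₚ ⟨
    1ₚ +ₚ 0ₚ                            ∎)
    where open ≡-Reasoning

  ⟨⟩-ΣF : ∀ a₀ a → ⟨ a₀ ∷ a , ΣF ⟩ ≡ a₀ +ₚ total a
  ⟨⟩-ΣF a₀ a = trans (cong (λ v → ⟨ a₀ ∷ a , v ⟩) ones-suc) (cong (_+ₚ total a) (*-identityʳ a₀))

  ⟨⟩-f₀⊕f' : ∀ a₀ a j → ⟨ a₀ ∷ a , f fzero ⊕ f' j ⟩ ≡ a₀ +ₚ lookup a j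
  ⟨⟩-f₀⊕f' a₀ a j = trans (⟨⟩-distribʳ (a₀ ∷ a) (f fzero) (f' j))
    (cong₂ _+ₚ_ (⟨⟩-basisʳ (a₀ ∷ a) fzero) (⟨⟩-basisʳ (a₀ ∷ a) (fsuc j)))

  ⟨⟩-f'⊕ΣF : ∀ a₀ a j → ⟨ a₀ ∷ a , f' j ⊕ ΣF ⟩ ≡ lookup a j +ₚ (a₀ +ₚ total a)
  ⟨⟩-f'⊕ΣF a₀ a j = trans (⟨⟩-distribʳ (a₀ ∷ a) (f' j) ΣF)
    (cong₂ _+ₚ_ (⟨⟩-basisʳ (a₀ ∷ a) (fsuc j)) (⟨⟩-ΣF a₀ a))

  T-coordinate-bit : ∀ {u} v → T (u , v) → ∀ k → IsBit (lookup u k)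
  T-coordinate-bit _ (inj₁ (i , inj₁ (refl , _))) k = subst IsBit (sym (lookup-basis i k)) (δ-bit i k)
  T-coordinate-bit _ (inj₁ (i , inj₂ (refl , _))) k with k ≟ i
  ... | yes refl = inj₁ (lookup-ones-except-self k)
  ... | no k≢i   = inj₂ (lookup-ones-except-≢ k≢i)
  T-coordinate-bit _ (inj₂ (refl , _)) k = inj₂ (lookup-ones k)

  T-total-bit : ∀ {u} v → T (u , v) → IsBit (total u)
  T-total-bit _ (inj₁ (i , inj₁ (refl , _))) = inj₂ (total-e i)
  T-total-bit _ (inj₁ (i , inj₂ (refl , _))) = inj₁ (total-ΣU-except i)
  T-total-bit _ (inj₂ (refl , _))            = inj₂ total-ΣU

  T-no-common-one : ∀ {u₁ u₂} v → T (u₁ ⊕ u₂ , v) → ∀ k → lookup u₁ k ≡ 1ₚ → lookup u₂ k ≡ 1ₚ → ⊥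
  T-no-common-one {u₁} {u₂} v t k one₁ one₂ =
    two-not-bit (subst IsBit (trans (lookup-⊕ u₁ u₂ k) (cong₂ _+ₚ_ one₁ one₂)) (T-coordinate-bit v t k))

  T-no-two-units : ∀ {u₁ u₂} v → T (u₁ ⊕ u₂ , v) → total u₁ ≡ 1ₚ → total u₂ ≡ 1ₚ → ⊥
  T-no-two-units {u₁} {u₂} v t one₁ one₂ =
    two-not-bit (subst IsBit (trans (total-additive u₁ u₂) (cong₂ _+ₚ_ one₁ one₂)) (T-total-bit v t))

  T-at-ΣU : ∀ v → T (ΣU , v) → ⟨ v , ΣF ⟩ ≡ 1ₚ
  T-at-ΣU _ (inj₂ (_ , on-C₁)) = on-C₁
  T-at-ΣU _ (inj₁ (i , inj₁ (ΣU≡eᵢ , _))) with fresh i i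
  ... | k , k≢i , _ = contradiction
    (trans (sym (lookup-ones k)) (trans (cong (λ u → lookup u k) ΣU≡eᵢ) (lookup-basis-≢ k≢i))) λ ()
  T-at-ΣU _ (inj₁ (i , inj₂ (ΣU≡ΣU-exceptᵢ , _))) = contradiction
    (trans (sym (lookup-ones i)) (trans (cong (λ u → lookup u i) ΣU≡ΣU-exceptᵢ) (lookup-ones-except-self i))) λ ()

  data Complementary (w₁ w₂ : W) : Set where
    A-B : ∀ j → A j w₁ → B j w₂ → Complementary w₁ w₂
    B-A : ∀ j → B j w₁ → A j w₂ → Complementary w₁ w₂

  complementary-sum : ∀ {u₁ v₁ u₂ v₂} → Complementary (u₁ , v₁) (u₂ , v₂) → u₁ ⊕ u₂ ≡ ΣU
  complementary-sum (A-B j (refl , _) (refl , _)) = basis⊕ones-except j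
  complementary-sum (B-A j (refl , _) (refl , _)) = trans (⊕-comm (ΣU-except j) (e j)) (basis⊕ones-except j)

  -- Every other pair of summands has a common coordinate 1 or two coordinate sums 1, producing a 2.
  T-sum-complementary : ∀ w₁ w₂ → T w₁ → T w₂ → T (w₁ ⊕W w₂) → Complementary w₁ w₂
  T-sum-complementary (_ , v₁) (_ , v₂) (inj₁ (i , inj₁ α@(refl , _))) (inj₁ (j , inj₂ β@(refl , _))) t
    with i ≟ j
  ... | yes refl = A-B i α β
  ... | no i≢j   = ⊥-elim (T-no-common-one (v₁ ⊕ v₂) t i (lookup-basis-diag i) (lookup-ones-except-≢ i≢j))
  T-sum-complementary (_ , v₁) (_ , v₂) (inj₁ (i , inj₂ β@(refl , _))) (inj₁ (j , inj₁ α@(refl , _))) t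
    with j ≟ i
  ... | yes refl = B-A j β α
  ... | no j≢i   = ⊥-elim (T-no-common-one (v₁ ⊕ v₂) t j (lookup-ones-except-≢ j≢i) (lookup-basis-diag j))
  T-sum-complementary (_ , v₁) (_ , v₂) (inj₁ (i , inj₂ (refl , _))) (inj₁ (j , inj₂ (refl , _))) t
    with fresh i j
  ... | k , k≢i , k≢j =
    ⊥-elim (T-no-common-one (v₁ ⊕ v₂) t k (lookup-ones-except-≢ k≢i) (lookup-ones-except-≢ k≢j))
  T-sum-complementary (_ , v₁) (_ , v₂) (inj₁ (i , inj₂ (refl , _))) (inj₂ (refl , _)) t with fresh i i
  ... | k , k≢i , _ = ⊥-elim (T-no-common-one (v₁ ⊕ v₂) t k (lookup-ones-except-≢ k≢i) (lookup-ones k))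
  T-sum-complementary (_ , v₁) (_ , v₂) (inj₂ (refl , _)) (inj₁ (j , inj₂ (refl , _))) t with fresh j j
  ... | k , k≢j , _ = ⊥-elim (T-no-common-one (v₁ ⊕ v₂) t k (lookup-ones k) (lookup-ones-except-≢ k≢j))
  T-sum-complementary (_ , v₁) (_ , v₂) (inj₁ (i , inj₁ (refl , _))) (inj₁ (j , inj₁ (refl , _))) t =
    ⊥-elim (T-no-two-units (v₁ ⊕ v₂) t (total-e i) (total-e j))
  T-sum-complementary (_ , v₁) (_ , v₂) (inj₁ (i , inj₁ (refl , _))) (inj₂ (refl , _)) t =
    ⊥-elim (T-no-two-units (v₁ ⊕ v₂) t (total-e i) total-ΣU)
  T-sum-complementary (_ , v₁) (_ , v₂) (inj₂ (refl , _)) (inj₁ (j , inj₁ (refl , _))) t =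
    ⊥-elim (T-no-two-units (v₁ ⊕ v₂) t total-ΣU (total-e j))
  T-sum-complementary (_ , v₁) (_ , v₂) (inj₂ (refl , _)) (inj₂ (refl , _)) t =
    ⊥-elim (T-no-two-units (v₁ ⊕ v₂) t total-ΣU total-ΣU)

  T-sum-at-ΣU : ∀ w₁ w₂ → T w₁ → T w₂ → T (w₁ ⊕W w₂) → proj₁ w₁ ⊕ proj₁ w₂ ≡ ΣU
  T-sum-at-ΣU w₁ w₂ t₁ t₂ t = complementary-sum (T-sum-complementary w₁ w₂ t₁ t₂ t)

  Ψ : U → W → Zp
  Ψ γ (u , v) = (⟨ u , γ ⟩ +ₚ (total u +ₚ total u)) -ₚ total (tail v)

  Ψ-additive : ∀ γ w w' → Ψ γ (w ⊕W w') ≡ Ψ γ w +ₚ Ψ γ w'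
  Ψ-additive γ (u , x₀ ∷ v) (u' , x₀' ∷ v') = begin
    (⟨ u ⊕ u' , γ ⟩ +ₚ (total (u ⊕ u') +ₚ total (u ⊕ u'))) -ₚ total (v ⊕ v')
      ≡⟨ cong₂ (λ a t → (a +ₚ (t +ₚ t)) -ₚ total (v ⊕ v')) (⟨⟩-distribˡ u u' γ) (total-additive u u') ⟩
    ((a +ₚ a') +ₚ ((t +ₚ t') +ₚ (t +ₚ t'))) -ₚ total (v ⊕ v')
      ≡⟨ cong₂ _-ₚ_ (trans (cong ((a +ₚ a') +ₚ_) (interchange t t' t t')) (interchange a a' _ _))
                    (total-additive v v') ⟩
    ((a +ₚ (t +ₚ t)) +ₚ (a' +ₚ (t' +ₚ t'))) -ₚ (total v +ₚ total v')
      ≡⟨ +-minus-interchange (a +ₚ (t +ₚ t)) (a' +ₚ (t' +ₚ t')) (total v) (total v') ⟩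
    Ψ γ (u , x₀ ∷ v) +ₚ Ψ γ (u' , x₀' ∷ v') ∎
    where
    open ≡-Reasoning
    a = ⟨ u , γ ⟩ ; a' = ⟨ u' , γ ⟩ ; t = total u ; t' = total u'

  Ψ-at-ΣU : ∀ c → Ψ (tail c) (ΣU , c) ≡ 1ₚ +ₚ 1ₚ
  Ψ-at-ΣU c = begin
    (⟨ ΣU , tail c ⟩ +ₚ (total ΣU +ₚ total ΣU)) -ₚ total (tail c)
      ≡⟨ cong₂ (λ a t → (a +ₚ (t +ₚ t)) -ₚ total (tail c)) (⟨⟩-comm ΣU (tail c)) total-ΣU ⟩
    (total (tail c) +ₚ (1ₚ +ₚ 1ₚ)) -ₚ total (tail c)
      ≡⟨ xyx⁻¹≈y (total (tail c)) (1ₚ +ₚ 1ₚ) ⟩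
    1ₚ +ₚ 1ₚ ∎
    where open ≡-Reasoning

  Ψ-A-summand : ∀ j {u₁ u₂} v₁ v₂ {c} → A j (u₁ , v₁) → B j (u₂ , v₂) → v₁ ⊕ v₂ ≡ c →
    ⟨ c , ΣF ⟩ ≡ 1ₚ → Ψ (tail c) (u₁ , v₁) ≡ 1ₚ
  Ψ-A-summand j (a₀ ∷ a) (b₀ ∷ b) (refl , on-Aⱼ) (refl , on-Bⱼ) refl on-C₁ = begin
    (⟨ e j , a ⊕ b ⟩ +ₚ (total (e j) +ₚ total (e j))) -ₚ sa
      ≡⟨ cong₂ (λ x t → (x +ₚ (t +ₚ t)) -ₚ sa) eⱼ-coordinate (total-e j) ⟩
    ((aⱼ +ₚ bⱼ) +ₚ (1ₚ +ₚ 1ₚ)) -ₚ sa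
      ≡⟨ cong (_-ₚ sa) (trans (sym (+-assoc (aⱼ +ₚ bⱼ) 1ₚ 1ₚ)) (cong (_+ₚ 1ₚ) key)) ⟩
    (sa +ₚ 1ₚ) -ₚ sa
      ≡⟨ xyx⁻¹≈y sa 1ₚ ⟩
    1ₚ ∎
    where
    open ≡-Reasoning
    aⱼ = lookup a j ; bⱼ = lookup b j ; sa = total a ; sb = total b

    eⱼ-coordinate : ⟨ e j , a ⊕ b ⟩ ≡ aⱼ +ₚ bⱼ
    eⱼ-coordinate = trans (⟨⟩-comm (e j) (a ⊕ b)) (trans (⟨⟩-basisʳ (a ⊕ b) j) (lookup-⊕ a b j))

    on-Aⱼ′ : a₀ +ₚ aⱼ ≡ 0ₚ
    on-Aⱼ′ = trans (sym (⟨⟩-f₀⊕f' a₀ a j)) on-Aⱼ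

    on-Bⱼ′ : bⱼ +ₚ (b₀ +ₚ sb) ≡ 0ₚ
    on-Bⱼ′ = trans (sym (⟨⟩-f'⊕ΣF b₀ b j)) on-Bⱼ

    on-C₁′ : (a₀ +ₚ b₀) +ₚ (sa +ₚ sb) ≡ 1ₚ
    on-C₁′ = trans (sym (trans (⟨⟩-ΣF (a₀ +ₚ b₀) (a ⊕ b)) (cong ((a₀ +ₚ b₀) +ₚ_) (total-additive a b)))) on-C₁

    rearrange : ∀ aⱼ bⱼ a₀ b₀ sa sb →
      (aⱼ +ₚ bⱼ) +ₚ ((a₀ +ₚ b₀) +ₚ (sa +ₚ sb)) ≡ ((a₀ +ₚ aⱼ) +ₚ (bⱼ +ₚ (b₀ +ₚ sb))) +ₚ sa
    rearrange = solve 6 (λ aⱼ bⱼ a₀ b₀ sa sb →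
      ((aⱼ ⊞ bⱼ) ⊞ ((a₀ ⊞ b₀) ⊞ (sa ⊞ sb))) ⊜ (((a₀ ⊞ aⱼ) ⊞ (bⱼ ⊞ (b₀ ⊞ sb))) ⊞ sa)) refl

    key : (aⱼ +ₚ bⱼ) +ₚ 1ₚ ≡ sa
    key = begin
      (aⱼ +ₚ bⱼ) +ₚ 1ₚ                          ≡⟨ cong ((aⱼ +ₚ bⱼ) +ₚ_) on-C₁′ ⟨
      (aⱼ +ₚ bⱼ) +ₚ ((a₀ +ₚ b₀) +ₚ (sa +ₚ sb))   ≡⟨ rearrange aⱼ bⱼ a₀ b₀ sa sb ⟩
      ((a₀ +ₚ aⱼ) +ₚ (bⱼ +ₚ (b₀ +ₚ sb))) +ₚ sa   ≡⟨ cong₂ (λ x y → (x +ₚ y) +ₚ sa) on-Aⱼ′ on-Bⱼ′ ⟩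
      (0ₚ +ₚ 0ₚ) +ₚ sa                          ≡⟨ cong (_+ₚ sa) (+-identityˡ 0ₚ) ⟩
      0ₚ +ₚ sa                                  ≡⟨ +-identityˡ sa ⟩
      sa                                        ∎

  Ψ-T-sum : ∀ w₁ w₂ {w} → T w₁ → T w₂ → T w → w₁ ⊕W w₂ ≡ w → Ψ (tail (proj₂ w)) w ≡ 1ₚ +ₚ 1ₚ
  Ψ-T-sum w₁@(_ , v₁) w₂@(_ , v₂) t₁ t₂ t refl rewrite T-sum-at-ΣU w₁ w₂ t₁ t₂ t = Ψ-at-ΣU (v₁ ⊕ v₂)

  Ψ-T-summand : ∀ w₁ w₂ {w} → T w₁ → T w₂ → T w → w₁ ⊕W w₂ ≡ w → Ψ (tail (proj₂ w)) w₁ ≡ 1ₚ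
  Ψ-T-summand w₁@(_ , v₁) w₂@(_ , v₂) t₁ t₂ t refl = from-complementary (T-sum-complementary w₁ w₂ t₁ t₂ t)
    where
    open ≡-Reasoning
    γ = tail (v₁ ⊕ v₂)

    on-C₁ : ⟨ v₁ ⊕ v₂ , ΣF ⟩ ≡ 1ₚ
    on-C₁ = T-at-ΣU (v₁ ⊕ v₂) (subst (λ u → T (u , v₁ ⊕ v₂)) (T-sum-at-ΣU w₁ w₂ t₁ t₂ t) t)

    from-complementary : Complementary w₁ w₂ → Ψ γ w₁ ≡ 1ₚ
    from-complementary (A-B j α β) = Ψ-A-summand j v₁ v₂ α β refl on-C₁
    -- Ψ is 2 on the sum and 1 on the Aⱼ-summand, so also 1 on the Bⱼ-summand.
    from-complementary (B-A j β α) = +-cancelʳ (Ψ γ w₂) (Ψ γ w₁) 1ₚ (begin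
      Ψ γ w₁ +ₚ Ψ γ w₂   ≡⟨ Ψ-additive γ w₁ w₂ ⟨
      Ψ γ (w₁ ⊕W w₂)     ≡⟨ Ψ-T-sum w₁ w₂ t₁ t₂ t refl ⟩
      1ₚ +ₚ 1ₚ           ≡⟨ cong (1ₚ +ₚ_) (Ψ-A-summand j v₂ v₁ α β (⊕-comm v₂ v₁) on-C₁) ⟨
      1ₚ +ₚ Ψ γ w₂       ∎)

  x y : Fin (suc p) → W
  x i = e i , zeroV
  y i = ΣU-except i , zeroV

  z : W
  z = ΣU , zeroV

  x⊕y≡z : ∀ i → x i ⊕W y i ≡ z
  x⊕y≡z i = cong₂ _,_ (basis⊕ones-except i) (⊕-identityˡ zeroV)

  x∈S : ∀ i → S (x i)
  x∈S i = inj₁ (i , inj₁ (refl , ⟨⟩-zeroˡ (f fzero ⊕ f' i)))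

  y∈S : ∀ i → S (y i)
  y∈S i = inj₁ (i , inj₂ (refl , ⟨⟩-zeroˡ (f' i ⊕ ΣF)))

  z∈S : S z
  z∈S = inj₂ (refl , ⟨⟩-zeroˡ ΣF)

  no-additive-map-S-into-T : (σ : W → W) → (∀ w w' → σ (w ⊕W w') ≡ σ w ⊕W σ w') → (∀ w → S w → T (σ w)) → ⊥
  no-additive-map-S-into-T σ σ-additive σ[S]⊆T = two-not-bit (inj₂ (trans (sym Ψσz≡2) Ψσz≡1))
    where
    open ≡-Reasoning
    γ = tail (proj₂ (σ z))

    σ-splits : ∀ i → σ (x i) ⊕W σ (y i) ≡ σ z
    σ-splits i = trans (sym (σ-additive (x i) (y i))) (cong σ (x⊕y≡z i))

    Ψσx≡1 : ∀ i → Ψ γ (σ (x i)) ≡ 1ₚ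
    Ψσx≡1 i = Ψ-T-summand (σ (x i)) (σ (y i)) (σ[S]⊆T _ (x∈S i)) (σ[S]⊆T _ (y∈S i)) (σ[S]⊆T z z∈S) (σ-splits i)

    Ψσz≡2 : Ψ γ (σ z) ≡ 1ₚ +ₚ 1ₚ
    Ψσz≡2 = Ψ-T-sum (σ (x fzero)) (σ (y fzero))
      (σ[S]⊆T _ (x∈S fzero)) (σ[S]⊆T _ (y∈S fzero)) (σ[S]⊆T z z∈S) (σ-splits fzero)

    g : U → Zp
    g u = Ψ γ (σ (u , zeroV))

    g-additive : Additive g
    g-additive u u' = begin
      Ψ γ (σ (u ⊕ u' , zeroV))                ≡⟨ cong (λ v → Ψ γ (σ (u ⊕ u' , v))) (⊕-identityˡ zeroV) ⟨
      Ψ γ (σ ((u , zeroV) ⊕W (u' , zeroV)))   ≡⟨ cong (Ψ γ) (σ-additive (u , zeroV) (u' , zeroV)) ⟩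
      Ψ γ (σ (u , zeroV) ⊕W σ (u' , zeroV))   ≡⟨ Ψ-additive γ (σ (u , zeroV)) (σ (u' , zeroV)) ⟩
      g u +ₚ g u'                             ∎

    Ψσz≡1 : Ψ γ (σ z) ≡ 1ₚ
    Ψσz≡1 = trans (additive-on-ones g g-additive Ψσx≡1) ⟦1+p⟧≡1

proposition2 : (p : ℕ) {{_ : NonZero p}} → Prime p → 2 < p →
    ¬ (Σ (Field.W p → Field.W p) λ σ → Field.IsGL p σ × Field.MapsOnto p σ (Field.S p) (Field.T p))
proposition2 (suc zero)          _ (s≤s ())
proposition2 (suc (suc zero))    _ (s≤s (s≤s ()))
proposition2 (suc (suc (suc m))) _ _ (σ , (σ-additive , _) , (σ[S]⊆T , _)) =
  Configuration.no-additive-map-S-into-T m σ σ-additive σ[S]⊆T
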